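{- Let $G$ be an $(n-3)$-regular graph of order $n\ge 5$ and let $B\subseteq E(G)$ be a Roman bondage set of $G$. Then $E_G(x)\cap B\neq\emptyset$ for every $x\in V(G)$.
   Context: All graphs are finite, simple and undirected. For a vertex $x$, $E_G(x)$ denotes the set of edges of $G$ incident with $x$. A Roman dominating function on $G=(V,E)$ is a function $f:V\to\{0,1,2\}$ such that every vertex $u$ with $f(u)=0$ is adjacent to some vertex $v$ with $f(v)=2$; its weight is $\sum_{u\in V}f(u)$, and $\gamma_{\rm R}(G)$ is the minimum weight of a Roman dominating function on $G$. A Roman bondage set of $G$ is a set $B\subseteq E(G)$ with $\gamma_{\rm R}(G-B)>\gamma_{\rm R}(G)$. -}

module Defs where

open import Data.Nat using (ℕ; zero; suc; _+_; _<_; _≤_; _∸_)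
open import Data.Bool using (Bool; true; false; _∧_; not; if_then_else_)
open import Data.Fin using (Fin; toℕ)
open import Data.List using (List; map; allFin)
open import Data.Nat.ListAction using (sum)
open import Data.Product using (Σ; ∃; _×_; _,_)
open import Relation.Binary.PropositionalEquality using (_≡_)

record Graph (n : ℕ) : Set where
  field
    adj   : Fin n → Fin n → Bool
    sym   : ∀ x y → adj x y ≡ adj y x
    irref : ∀ x → adj x x ≡ false
open Graph public

record EdgeSet {n : ℕ} (G : Graph n) : Set where
  field
    mem    : Fin n → Fin n → Bool
    memSym : ∀ x y → mem x y ≡ mem y x
    sub    : ∀ x y → mem x y ≡ true → adj G x y ≡ true
open EdgeSet public

_∖E_ : ∀ {n} (G : Graph n) → EdgeSet G → Graph n
G ∖E B = record
  { adj   = λ x y → adj G x y ∧ not (mem B x y)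
  ; sym   = λ x y → cong₂' (sym G x y) (memSym B x y)
  ; irref = λ x → irr (adj G x x) (irref G x)
  }
  where
  open import Relation.Binary.PropositionalEquality using (refl)
  cong₂' : ∀ {a b c d : Bool} → a ≡ b → c ≡ d → (a ∧ not c) ≡ (b ∧ not d)
  cong₂' refl refl = refl
  irr : ∀ {c} (a : Bool) → a ≡ false → (a ∧ c) ≡ false
  irr false _ = refl
  irr true ()

b2n : Bool → ℕ
b2n true  = 1
b2n false = 0

degree : ∀ {n} → Graph n → Fin n → ℕ
degree {n} G x = sum (map (λ y → b2n (adj G x y)) (allFin n))

Regular : ∀ {n} → Graph n → ℕ → Set
Regular {n} G r = ∀ x → degree G x ≡ r

RDF : ∀ {n} → Graph n → (Fin n → Fin 3) → Set
RDF {n} G f = ∀ u → toℕ (f u) ≡ 0 → ∃ λ v → adj G u v ≡ true × toℕ (f v) ≡ 2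

weight : ∀ {n} → (Fin n → Fin 3) → ℕ
weight {n} f = sum (map (λ u → toℕ (f u)) (allFin n))

IsRomanDomNumber : ∀ {n} → Graph n → ℕ → Set
IsRomanDomNumber {n} G k =
  (Σ (Fin n → Fin 3) λ f → RDF G f × weight f ≡ k) ×
  (∀ (f : Fin n → Fin 3) → RDF G f → k ≤ weight f)

RomanBondageSet : ∀ {n} (G : Graph n) → EdgeSet G → Set
RomanBondageSet G B =
  ∀ k k' → IsRomanDomNumber G k → IsRomanDomNumber (G ∖E B) k' → k < k'

-- For a graph H on n vertices whose maximum degree is n − 3, attained at x, γR(H) = 4:
-- the function 2 at x, 0 on the neighbours of x and 1 on the two remaining vertices
-- is Roman dominating of weight 4, and no Roman dominating function is lighter. If
-- no edge of B met x, then G − B would again have maximum degree n − 3 attained at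
-- x, so γR(G − B) = 4 = γR(G), contradicting that B is a Roman bondage set.
module Submission where

open import Defs hiding (sym)
open import Data.Bool using (true; false; _∧_; not)
open import Data.Bool.Properties using (∧-identityʳ; ¬-not) renaming (_≟_ to _≟ᵇ_)
open import Data.Empty using (⊥-elim)
open import Data.Fin using (Fin; toℕ; _≟_; punchIn) renaming (zero to fzero; suc to fsuc)
open import Data.Fin.Properties using (any?; punchInᵢ≢i)
open import Data.List using (map; allFin; tabulate)
open import Data.List.Properties using (map-tabulate)
open import Data.Nat using (ℕ; zero; suc; _+_; _≤_; _∸_; z≤n; s≤s)
open import Data.Nat.ListAction using (sum)
open import Data.Nat.Properties
  using (+-0-commutativeMonoid; +-mono-≤; +-monoʳ-≤; +-cancelʳ-≡; +-cancelʳ-≤;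
         ≤-trans; ≤-reflexive; <-irrefl; m+[n∸m]≡n; module ≤-Reasoning)
  renaming (_≟_ to _≟ℕ_)
open import Algebra.Properties.CommutativeMonoid.Sum +-0-commutativeMonoid
  using (sum-syntax; ∑-distrib-+; sum-cong-≗; sum-remove; sum-replicate-zero)
  renaming (sum to ∑)
open import Data.Product using (∃; _×_; _,_)
open import Function using (_∘_)
open import Relation.Nullary using (yes; no; does)
open import Relation.Nullary.Decidable using (dec-true; dec-false; _×-dec_; ¬?)
open import Relation.Binary.PropositionalEquality
  using (_≡_; _≢_; refl; sym; trans; cong; cong₂; module ≡-Reasoning)

private
  variable
    n : ℕ

sum-tabulate : (g : Fin n → ℕ) → sum (tabulate g) ≡ ∑ g
sum-tabulate {zero}  g = refl
sum-tabulate {suc n} g = cong (g fzero +_) (sum-tabulate (g ∘ fsuc))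

sum-map-allFin : (g : Fin n → ℕ) → sum (map g (allFin n)) ≡ ∑ g
sum-map-allFin g = trans (cong sum (map-tabulate (λ y → y) g)) (sum-tabulate g)

∑-mono-≤ : {g h : Fin n → ℕ} → (∀ y → g y ≤ h y) → ∑ g ≤ ∑ h
∑-mono-≤ {zero}  g≤h = z≤n
∑-mono-≤ {suc n} g≤h = +-mono-≤ (g≤h fzero) (∑-mono-≤ (g≤h ∘ fsuc))

∑-const-1 : ∑[ y < n ] 1 ≡ n
∑-const-1 {zero}  = refl
∑-const-1 {suc n} = cong suc ∑-const-1

δ : Fin n → Fin n → ℕ
δ x y = b2n (does (x ≟ y))

∑-δ : (x : Fin n) → ∑ (δ x) ≡ 1
∑-δ {suc n} x = begin
  ∑ (δ x)                          ≡⟨ sum-remove (δ x) ⟩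
  δ x x + ∑ (δ x ∘ punchIn x)      ≡⟨ cong₂ _+_ (cong b2n (dec-true (x ≟ x) refl))
                                                (sum-cong-≗ off-diagonal) ⟩
  1 + ∑[ y < n ] 0                 ≡⟨ cong suc (sum-replicate-zero n) ⟩
  1                                ∎
  where
  open ≡-Reasoning
  off-diagonal : ∀ y → δ x (punchIn x y) ≡ 0
  off-diagonal y = cong b2n (dec-false (x ≟ punchIn x y) (punchInᵢ≢i x y ∘ sym))

∑-δ+1 : (x : Fin n) → ∑[ y < n ] (δ x y + 1) ≡ suc n
∑-δ+1 x = trans (∑-distrib-+ (δ x) (λ _ → 1)) (cong₂ _+_ (∑-δ x) ∑-const-1)

weight-∑ : (f : Fin n → Fin 3) → weight f ≡ ∑[ y < n ] toℕ (f y)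
weight-∑ f = sum-map-allFin (toℕ ∘ f)

degree-∑ : (H : Graph n) (x : Fin n) → degree H x ≡ ∑[ y < n ] b2n (adj H x y)
degree-∑ H x = sum-map-allFin (b2n ∘ adj H x)

weight+degree-∑ : (H : Graph n) (f : Fin n → Fin 3) (x : Fin n) →
                  weight f + degree H x ≡ ∑[ y < n ] (toℕ (f y) + b2n (adj H x y))
weight+degree-∑ H f x =
  trans (cong₂ _+_ (weight-∑ f) (degree-∑ H x)) (sym (∑-distrib-+ (toℕ ∘ f) (b2n ∘ adj H x)))

weight-with-two-2s : (f : Fin n → Fin 3) {u v : Fin n} → u ≢ v →
                     toℕ (f u) ≡ 2 → toℕ (f v) ≡ 2 → 4 ≤ weight f
weight-with-two-2s {n} f {u} {v} u≢v fu≡2 fv≡2 = begin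
  4                                               ≡⟨ sym four ⟩
  ∑[ y < n ] ((δ u y + δ u y) + (δ v y + δ v y))  ≤⟨ ∑-mono-≤ pointwise ⟩
  ∑[ y < n ] toℕ (f y)                            ≡⟨ sym (weight-∑ f) ⟩
  weight f                                        ∎
  where
  open ≤-Reasoning
  twice : (x : Fin n) → ∑[ y < n ] (δ x y + δ x y) ≡ 2
  twice x = trans (∑-distrib-+ (δ x) (δ x)) (cong₂ _+_ (∑-δ x) (∑-δ x))
  four : ∑[ y < n ] ((δ u y + δ u y) + (δ v y + δ v y)) ≡ 4
  four = trans (∑-distrib-+ (λ y → δ u y + δ u y) (λ y → δ v y + δ v y)) (cong₂ _+_ (twice u) (twice v))
  pointwise : ∀ y → (δ u y + δ u y) + (δ v y + δ v y) ≤ toℕ (f y)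
  pointwise y with u ≟ y | v ≟ y
  ... | yes refl | yes refl = ⊥-elim (u≢v refl)
  ... | yes refl | no _     = ≤-reflexive (sym fu≡2)
  ... | no _     | yes refl = ≤-reflexive (sym fv≡2)
  ... | no _     | no _     = z≤n

module _ (H : Graph n) where

  star : Fin n → Fin n → Fin 3
  star x y with x ≟ y
  ... | yes _ = fsuc (fsuc fzero)
  ... | no  _ with adj H x y
  ...   | true  = fzero
  ...   | false = fsuc fzero

  star-rdf : (x : Fin n) → RDF H (star x)
  star-rdf x u fu≡0 with x ≟ u
  star-rdf x u () | yes _
  ... | no _ with adj H x u in xu
  ...   | true  = x , trans (Graph.sym H u x) xu , star-centre
    where
    star-centre : toℕ (star x x) ≡ 2
    star-centre with x ≟ x
    ... | yes _  = refl
    ... | no x≢x = ⊥-elim (x≢x refl)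
  star-rdf x u () | no _ | false

  star+adj : (x y : Fin n) → toℕ (star x y) + b2n (adj H x y) ≡ δ x y + 1
  star+adj x y with x ≟ y
  ... | yes refl rewrite irref H x = refl
  ... | no _ with adj H x y
  ...   | true  = refl
  ...   | false = refl

  weight-star : (x : Fin n) → weight (star x) + degree H x ≡ suc n
  weight-star x = trans (weight+degree-∑ H (star x) x)
                        (trans (sum-cong-≗ (star+adj x)) (∑-δ+1 x))

  module _ {f : Fin n → Fin 3} (rdf : RDF H f) where

    weight-without-2 : (∀ u → toℕ (f u) ≢ 2) → n ≤ weight f
    weight-without-2 no-2 = begin
      n                      ≡⟨ sym ∑-const-1 ⟩
      ∑[ y < n ] 1           ≤⟨ ∑-mono-≤ positive ⟩
      ∑[ y < n ] toℕ (f y)   ≡⟨ sym (weight-∑ f) ⟩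
      weight f               ∎
      where
      open ≤-Reasoning
      positive : ∀ y → 1 ≤ toℕ (f y)
      positive y with f y in fy
      ... | fsuc _ = s≤s z≤n
      ... | fzero with rdf y (cong toℕ fy)
      ...   | v , _ , fv≡2 = ⊥-elim (no-2 v fv≡2)

    -- A vertex y ≠ u labelled 0 can only be dominated by u, so it is adjacent to u.
    weight-with-unique-2 : (u : Fin n) → toℕ (f u) ≡ 2 →
                           (∀ v → u ≢ v → toℕ (f v) ≢ 2) →
                           suc n ≤ weight f + degree H u
    weight-with-unique-2 u fu≡2 unique = begin
      suc n                                          ≡⟨ sym (∑-δ+1 u) ⟩
      ∑[ y < n ] (δ u y + 1)                         ≤⟨ ∑-mono-≤ pointwise ⟩
      ∑[ y < n ] (toℕ (f y) + b2n (adj H u y))       ≡⟨ sym (weight+degree-∑ H f u) ⟩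
      weight f + degree H u                          ∎
      where
      open ≤-Reasoning
      pointwise : ∀ y → δ u y + 1 ≤ toℕ (f y) + b2n (adj H u y)
      pointwise y with u ≟ y
      ... | yes refl rewrite fu≡2 = s≤s (s≤s z≤n)
      ... | no u≢y with f y in fy
      ...   | fsuc _ = s≤s z≤n
      ...   | fzero with rdf y (cong toℕ fy)
      ...     | v , yv , fv≡2 with u ≟ v
      ...       | no u≢v   = ⊥-elim (unique v u≢v fv≡2)
      ...       | yes refl rewrite Graph.sym H u y | yv = s≤s z≤n

  weight-≥4 : {d : ℕ} → 4 ≤ n → 3 + d ≤ n → (∀ y → degree H y ≤ d) →
              (f : Fin n → Fin 3) → RDF H f → 4 ≤ weight f
  weight-≥4 {d} 4≤n 3+d≤n Δ≤d f rdf with any? (λ u → toℕ (f u) ≟ℕ 2)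
  ... | no no-2 = ≤-trans 4≤n (weight-without-2 rdf (λ u fu≡2 → no-2 (u , fu≡2)))
  ... | yes (u , fu≡2) with any? (λ v → ¬? (u ≟ v) ×-dec (toℕ (f v) ≟ℕ 2))
  ...   | yes (v , u≢v , fv≡2) = weight-with-two-2s f u≢v fu≡2 fv≡2
  ...   | no unique = +-cancelʳ-≤ d 4 (weight f) (begin
    4 + d                  ≤⟨ s≤s 3+d≤n ⟩
    suc n                  ≤⟨ weight-with-unique-2 rdf u fu≡2 (λ v u≢v fv≡2 → unique (v , u≢v , fv≡2)) ⟩
    weight f + degree H u  ≤⟨ +-monoʳ-≤ (weight f) (Δ≤d u) ⟩
    weight f + d           ∎)
    where open ≤-Reasoning

  γR≡4 : {d : ℕ} → 4 ≤ n → 3 + d ≡ n → (∀ y → degree H y ≤ d) →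
         (x : Fin n) → degree H x ≡ d → IsRomanDomNumber H 4
  γR≡4 {d} 4≤n 3+d≡n Δ≤d x deg-x =
    (star x , star-rdf x , weight-star≡4) , weight-≥4 4≤n (≤-reflexive 3+d≡n) Δ≤d
    where
    weight-star≡4 : weight (star x) ≡ 4
    weight-star≡4 = +-cancelʳ-≡ d (weight (star x)) 4
      (trans (cong (weight (star x) +_) (sym deg-x))
             (trans (weight-star x) (cong suc (sym 3+d≡n))))

degree-∖E-≤ : (G : Graph n) (B : EdgeSet G) (y : Fin n) → degree (G ∖E B) y ≤ degree G y
degree-∖E-≤ G B y = begin
  degree (G ∖E B) y                                  ≡⟨ degree-∑ (G ∖E B) y ⟩
  ∑[ z < _ ] b2n (adj G y z ∧ not (mem B y z))       ≤⟨ ∑-mono-≤ (λ z → b2n-∧-≤ (adj G y z)) ⟩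
  ∑[ z < _ ] b2n (adj G y z)                         ≡⟨ sym (degree-∑ G y) ⟩
  degree G y                                         ∎
  where
  open ≤-Reasoning
  b2n-∧-≤ : ∀ a {b} → b2n (a ∧ b) ≤ b2n a
  b2n-∧-≤ false         = z≤n
  b2n-∧-≤ true {false}  = z≤n
  b2n-∧-≤ true {true}   = s≤s z≤n

degree-∖E-≡ : (G : Graph n) (B : EdgeSet G) (x : Fin n) → (∀ y → mem B x y ≡ false) →
              degree (G ∖E B) x ≡ degree G x
degree-∖E-≡ G B x x∉B = begin
  degree (G ∖E B) x                                  ≡⟨ degree-∑ (G ∖E B) x ⟩
  ∑[ z < _ ] b2n (adj G x z ∧ not (mem B x z))       ≡⟨ sum-cong-≗ unchanged ⟩
  ∑[ z < _ ] b2n (adj G x z)                         ≡⟨ sym (degree-∑ G x) ⟩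
  degree G x                                         ∎
  where
  open ≡-Reasoning
  unchanged : ∀ z → b2n (adj G x z ∧ not (mem B x z)) ≡ b2n (adj G x z)
  unchanged z = cong b2n (trans (cong (λ b → adj G x z ∧ not b) (x∉B z))
                                (∧-identityʳ (adj G x z)))

lemma2p5 : (n : ℕ) → 5 ≤ n → (G : Graph n) → Regular G (n ∸ 3) →
           (B : EdgeSet G) → RomanBondageSet G B →
           (x : Fin n) → ∃ λ y → adj G x y ≡ true × mem B x y ≡ true
lemma2p5 n 5≤n G regular B bondage x with any? (λ y → mem B x y ≟ᵇ true)
... | yes (y , xy∈B) = y , sub B x y xy∈B , xy∈B
... | no no-edge = ⊥-elim (<-irrefl refl (bondage 4 4 γR[G]≡4 γR[G∖B]≡4))
  where
  4≤n : 4 ≤ n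
  4≤n = ≤-trans (s≤s (s≤s (s≤s (s≤s z≤n)))) 5≤n
  3+d≡n : 3 + (n ∸ 3) ≡ n
  3+d≡n = m+[n∸m]≡n (≤-trans (s≤s (s≤s (s≤s z≤n))) 5≤n)
  x∉B : ∀ y → mem B x y ≡ false
  x∉B y = ¬-not (no-edge ∘ (y ,_))
  γR[G]≡4 : IsRomanDomNumber G 4
  γR[G]≡4 = γR≡4 G 4≤n 3+d≡n (≤-reflexive ∘ regular) x (regular x)
  γR[G∖B]≡4 : IsRomanDomNumber (G ∖E B) 4
  γR[G∖B]≡4 = γR≡4 (G ∖E B) 4≤n 3+d≡n
    (λ y → ≤-trans (degree-∖E-≤ G B y) (≤-reflexive (regular y))) x
    (trans (degree-∖E-≡ G B x x∉B) (regular x))
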